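{- Let $T$ be a tree rooted at a non-leaf vertex $r$, with leaves $l_1,\ldots,l_m$ numbered in the order in which they appear in some depth-first traversal of $T$ starting from $r$, and let $k\geq 1$. For $0\leq i\leq k-1$, let $I_i$ be the interval graph on $V(T)$ in which distinct $u,v$ are adjacent iff $f_i(u)\cap f_i(v)\neq\emptyset$, where $f_i(u)=[s(p^i(u)),\,t(p^{k-1-i}(u))]$. Then for every $0\leq i\leq k-1$, $I_i$ is a supergraph of $T^k$, i.e. $E(T^k)\subseteq E(I_i)$.
   Context: $T^k$ is the graph on $V(T)$ in which distinct $u,v$ are adjacent iff their distance in $T$ is at most $k$. For vertices $u,v$, $u\preceq v$ means $u$ lies on the unique path from $r$ to $v$ in $T$. For $u\neq r$, $p(u)$ is the neighbour of $u$ on the path from $u$ to $r$, and $p(r)=r$; $p^0(u)=u$ and $p^j(u)=p(p^{j-1}(u))$ for $j\geq 1$. For a vertex $u$, $L(u)=\{i : u\preceq l_i\}$, $s(u)=\min L(u)$ and $t(u)=\max L(u)$. (Each $f_i(u)$ is a valid closed interval, since $p^i(u)$ and $p^{k-1-i}(u)$ are comparable under $\preceq$.) -}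

module Defs where

open import Data.Nat using (ℕ; zero; suc; _≤_; _<_; _∸_)
open import Data.Fin using (Fin; toℕ)
open import Data.Product using (Σ; _×_; ∃; _,_)
open import Data.Sum using (_⊎_)
open import Relation.Binary.PropositionalEquality using (_≡_; _≢_)
open import Relation.Nullary using (¬_)
open import Function using (_⇔_)
open import Function.Definitions using (Injective)

-- A rooted tree on vertex set Fin n is given by its root r and parent map p
-- (p r = r, and every vertex reaches r by iterating p).  The edges of T are
-- the pairs {u, p u} with u ≠ r.

iter : ∀ {n} → (Fin n → Fin n) → ℕ → Fin n → Fin n
iter p zero u = u
iter p (suc j) u = p (iter p j u)

record RootedTree (n : ℕ) : Set where
  field
    root   : Fin n
    parent : Fin n → Fin n
    parent-root : parent root ≡ root
    reaches-root : ∀ v → ∃ λ j → iter parent j v ≡ root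

module _ {n : ℕ} (T : RootedTree n) where
  open RootedTree T

  Adj : Fin n → Fin n → Set
  Adj u v = u ≢ v × (parent u ≡ v ⊎ parent v ≡ u)

  data Walk : ℕ → Fin n → Fin n → Set where
    here : ∀ {u} → Walk zero u u
    step : ∀ {j u v w} → Adj u v → Walk j v w → Walk (suc j) u w

  DistLe : ℕ → Fin n → Fin n → Set
  DistLe k u v = ∃ λ j → j ≤ k × Walk j u v

  PowerEdge : ℕ → Fin n → Fin n → Set
  PowerEdge k u v = u ≢ v × DistLe k u v

  Anc : Fin n → Fin n → Set
  Anc u v = ∃ λ j → iter parent j v ≡ u

  Leaf : Fin n → Set
  Leaf v = ∃ λ w → Adj v w × (∀ w' → Adj v w' → w' ≡ w)

  -- σ lists the vertices in the order of a depth-first traversal from r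
  -- (preorder): σ is a bijection, σ starts at r, and each next vertex is a
  -- child of a vertex on the current root-path (an ancestor of the previous one).
  IsDFSOrder : (Fin n → Fin n) → Set
  IsDFSOrder σ =
    Injective _≡_ _≡_ σ
    × (∀ a → toℕ a ≡ 0 → σ a ≡ root)
    × (∀ a b → toℕ b ≡ suc (toℕ a) → Anc (parent (σ b)) (σ a))

  -- l : Fin m → Fin n enumerates the leaves (l_0,...,l_{m-1}) in the order
  -- in which they appear in the traversal σ.
  IsLeafNumbering : (Fin n → Fin n) → (m : ℕ) → (Fin m → Fin n) → Set
  IsLeafNumbering σ m l =
    Injective _≡_ _≡_ l
    × (∀ v → Leaf v ⇔ (∃ λ i → l i ≡ v))
    × (∀ i i' a b → σ a ≡ l i → σ b ≡ l i' → toℕ i < toℕ i' → toℕ a < toℕ b)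

  -- L(u) = { i : u ⪯ l_i };  s(u) = min L(u),  t(u) = max L(u)
  InL : ∀ {m} → (Fin m → Fin n) → Fin n → Fin m → Set
  InL l u i = Anc u (l i)

  IsS : ∀ {m} → (Fin m → Fin n) → (Fin n → Fin m) → Set
  IsS l s = ∀ u → InL l u (s u) × (∀ i → InL l u i → toℕ (s u) ≤ toℕ i)

  IsT : ∀ {m} → (Fin m → Fin n) → (Fin n → Fin m) → Set
  IsT l t = ∀ u → InL l u (t u) × (∀ i → InL l u i → toℕ i ≤ toℕ (t u))

Intersect : ℕ → ℕ → ℕ → ℕ → Set
Intersect a b c d = ∃ λ x → (a ≤ x × x ≤ b) × (c ≤ x × x ≤ d)

IEdge : ∀ {n m} → RootedTree n → (s t : Fin n → Fin m) → ℕ → ℕ → Fin n → Fin n → Set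
IEdge T s t k i u v =
  u ≢ v ×
  Intersect (toℕ (s (iter p i u))) (toℕ (t (iter p (k ∸ 1 ∸ i) u)))
            (toℕ (s (iter p i v))) (toℕ (t (iter p (k ∸ 1 ∸ i) v)))
  where p = RootedTree.parent T

module Submission where

-- Two closed intervals [a,b], [c,d] meet as soon as each left end is at most
-- each right end (witness: max a c).  Each of the four inequalities has the
-- form s(X) ≤ t(Y) where X = p^i x and Y = p^{k-1-i} y for x, y ∈ {u, v},
-- and s(X) ≤ t(Y) holds whenever X and Y are comparable under ⪯: the lower
-- of the two has a leaf below it that is also below the upper one.
-- For x = y comparability is clear (both are ancestors of x).  For x ≠ y we
-- use that a walk of length ≤ k from u to v yields a common ancestor
-- p^a u = p^b v with a + b ≤ k = i + (k-1-i) + 1; hence a ≤ i or b ≤ k-1-i,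
-- i.e. one of p^i u, p^{k-1-i} v is at or above the meeting point and so is
-- an ancestor of both u and v.

open import Defs
open import Data.Nat using (ℕ; zero; suc; _+_; _∸_; _⊔_; _≤_; _<_; z≤n; s≤s; _≤?_)
open import Data.Nat.Properties
open import Data.Fin using (Fin; toℕ)
open import Data.Product using (∃; _×_; _,_; proj₁; proj₂)
open import Data.Sum using (_⊎_; inj₁; inj₂)
open import Relation.Nullary using (¬_; yes; no)
open import Relation.Binary.PropositionalEquality

intervals-meet : ∀ {a b c d} → a ≤ b → a ≤ d → c ≤ b → c ≤ d → Intersect a b c d
intervals-meet {a} {c = c} a≤b a≤d c≤b c≤d =
  a ⊔ c , (m≤m⊔n a c , ⊔-lub a≤b c≤b) , (m≤n⊔m a c , ⊔-lub a≤d c≤d)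

module _ {n : ℕ} (T : RootedTree n) where
  open RootedTree T

  anc : ℕ → Fin n → Fin n
  anc = iter parent

  anc-+ : ∀ d j y → anc (d + j) y ≡ anc d (anc j y)
  anc-+ zero    j y = refl
  anc-+ (suc d) j y = cong parent (anc-+ d j y)

  anc-suc : ∀ a u → anc (suc a) u ≡ anc a (parent u)
  anc-suc zero    u = refl
  anc-suc (suc a) u = cong parent (anc-suc a u)

  Anc-trans : ∀ {x y z} → Anc T x y → Anc T y z → Anc T x z
  Anc-trans {x} {y} {z} (d , pᵈy≡x) (j , pʲz≡y) =
    d + j , trans (anc-+ d j z) (trans (cong (anc d) pʲz≡y) pᵈy≡x)

  Comparable : Fin n → Fin n → Set
  Comparable X Y = Anc T X Y ⊎ Anc T Y X

  anc-⪯ : ∀ y {j j'} → j ≤ j' → Anc T (anc j' y) (anc j y)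
  anc-⪯ y {j} {j'} j≤j' =
    j' ∸ j , trans (sym (anc-+ (j' ∸ j) j y)) (cong (λ q → anc q y) (m∸n+n≡m j≤j'))

  anc-comparable : ∀ y j j' → Comparable (anc j y) (anc j' y)
  anc-comparable y j j' with j ≤? j'
  ... | yes j≤j' = inj₂ (anc-⪯ y j≤j')
  ... | no  j≰j' = inj₁ (anc-⪯ y (<⇒≤ (≰⇒> j≰j')))

  -- A walk of length j from u to v reaches a common ancestor p^a u = p^b v
  -- with a + b ≤ j (each step either climbs from u or is undone later).
  walk-meet : ∀ {j u v} → Walk T j u v → ∃ λ a → ∃ λ b → a + b ≤ j × anc a u ≡ anc b v
  walk-meet here = 0 , 0 , z≤n , refl
  walk-meet {u = u} (step (_ , inj₁ pu≡u') w) with walk-meet w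
  ... | a , b , a+b≤j , e =
    suc a , b , s≤s a+b≤j , trans (anc-suc a u) (trans (cong (anc a) pu≡u') e)
  walk-meet (step (_ , inj₂ pu'≡u) w) with walk-meet w
  ... | zero  , b , a+b≤j , e = 0 , suc b , s≤s a+b≤j , trans (sym pu'≡u) (cong parent e)
  walk-meet (step {v = u'} (_ , inj₂ pu'≡u) w) | suc a , b , a+b≤j , e =
    a , b , m≤n⇒m≤1+n (<⇒≤ a+b≤j) ,
    trans (cong (anc a) (sym pu'≡u)) (trans (sym (anc-suc a u')) e)

  meet-shift : ∀ {a b u v} i → anc a u ≡ anc b v → a ≤ i → anc i u ≡ anc (i ∸ a + b) v
  meet-shift {a} {b} {u} {v} i e a≤i = begin
    anc i u                ≡⟨ cong (λ q → anc q u) (sym (m∸n+n≡m a≤i)) ⟩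
    anc (i ∸ a + a) u      ≡⟨ anc-+ (i ∸ a) a u ⟩
    anc (i ∸ a) (anc a u)  ≡⟨ cong (anc (i ∸ a)) e ⟩
    anc (i ∸ a) (anc b v)  ≡⟨ sym (anc-+ (i ∸ a) b v) ⟩
    anc (i ∸ a + b) v      ∎
    where open ≡-Reasoning

  -- If u and v meet at p^a u = p^b v with a + b ≤ i + i' + 1, then p^i u and
  -- p^{i'} v are comparable: either p^i u or p^{i'} v is past the meeting
  -- point and hence an ancestor of the other vertex.
  meet⇒comparable : ∀ {a b u v} i i' → a + b ≤ suc (i + i') → anc a u ≡ anc b v →
                    Comparable (anc i u) (anc i' v)
  meet⇒comparable {a} {b} {u} {v} i i' a+b≤ e with a ≤? i
  ... | yes a≤i =
    subst (λ X → Comparable X (anc i' v)) (sym (meet-shift i e a≤i))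
          (anc-comparable v (i ∸ a + b) i')
  ... | no  a≰i =
    subst (λ Y → Comparable (anc i u) Y) (sym (meet-shift i' (sym e) b≤i'))
          (anc-comparable u i (i' ∸ b + a))
    where
    b≤i' : b ≤ i'
    b≤i' = +-cancelˡ-≤ i b i' (≤-pred (≤-trans (+-monoˡ-≤ b (≰⇒> a≰i)) a+b≤))

  module _ {m} {l : Fin m → Fin n} {s t : Fin n → Fin m} (S : IsS T l s) (Tt : IsT T l t) where
    -- For comparable X, Y some leaf index lies in L(X) ∩ L(Y) between
    -- s(X) and t(Y): the leaves below the lower vertex are below the upper one.
    s≤t : ∀ {X Y} → Comparable X Y → toℕ (s X) ≤ toℕ (t Y)
    s≤t {X} {Y} (inj₁ X⪯Y) = proj₂ (S X) (t Y) (Anc-trans X⪯Y (proj₁ (Tt Y)))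
    s≤t {X} {Y} (inj₂ Y⪯X) = proj₂ (Tt Y) (s X) (Anc-trans Y⪯X (proj₁ (S X)))

split-exponent : ∀ {k i} → i < k → suc (i + (k ∸ 1 ∸ i)) ≡ k
split-exponent {k} {i} i<k = begin
  suc (i + (k ∸ 1 ∸ i))  ≡⟨ cong (λ q → suc (i + q)) (∸-+-assoc k 1 i) ⟩
  suc i + (k ∸ suc i)    ≡⟨ m+[n∸m]≡n i<k ⟩
  k                      ∎
  where open ≡-Reasoning

lemma7 : ∀ {n m : ℕ} (T : RootedTree n) (σ : Fin n → Fin n) (l : Fin m → Fin n)
           (s t : Fin n → Fin m) (k i : ℕ) →
           ¬ Leaf T (RootedTree.root T) →
           IsDFSOrder T σ →
           IsLeafNumbering T σ m l →
           IsS T l s → IsT T l t →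
           1 ≤ k → i < k →
           ∀ u v → PowerEdge T k u v → IEdge T s t k i u v
lemma7 T σ l s t k i _ _ _ S Tt _ i<k u v (u≢v , j , j≤k , w) with walk-meet T w
... | a , b , a+b≤j , e =
  u≢v , intervals-meet (s≤t T S Tt (anc-comparable T u i i'))
                       (s≤t T S Tt (meet⇒comparable T {a} {b} i i' a+b≤ e))
                       (s≤t T S Tt (meet⇒comparable T {b} {a} i i' b+a≤ (sym e)))
                       (s≤t T S Tt (anc-comparable T v i i'))
  where
  i' = k ∸ 1 ∸ i
  a+b≤ : a + b ≤ suc (i + i')
  a+b≤ = subst (a + b ≤_) (sym (split-exponent i<k)) (≤-trans a+b≤j j≤k)
  b+a≤ : b + a ≤ suc (i + i')
  b+a≤ = subst (_≤ suc (i + i')) (+-comm a b) a+b≤
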